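{- Let $n\ge1$. (i) For every $k\ge3$ there is a bijection between $\{\pi\in\mathfrak{G}^{\mathrm{I}}_{2n}:\pi_1=k,\ \pi_{2n}\ne2\}$ and $\{\pi\in\mathfrak{G}^{\mathrm{I}}_{2n}:\pi_1=k,\ \pi_{2n}=2\}$; in particular $G^{\mathrm{I}}_{2n,k}$ is even for every $k\ge3$. (ii) $G^{\mathrm{I}}_{2n,1}=G^{\mathrm{I}}_{2n,2}$.
   Context: $\mathfrak{G}^{\mathrm{I}}_{2n}$ is the set of permutations $\pi=\pi_1\cdots\pi_{2n}$ of $[2n]$ such that every ascent $\pi_i<\pi_{i+1}$ has $\pi_i$ odd and $\pi_{i+1}$ even. $G^{\mathrm{I}}_{2n,k}$ is the number of $\pi\in\mathfrak{G}^{\mathrm{I}}_{2n}$ with $\pi_1=k$ (zero if $k>2n$). -}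

module Defs where

open import Data.Nat using (ℕ; zero; suc; _+_; _*_; _<_; _<?_)
open import Data.Nat.Properties using (_≟_)
open import Data.Nat.Divisibility using (_∣_; _∣?_)
open import Data.Fin using (Fin; toℕ)
open import Data.Fin.Properties using () renaming (all? to allFin?)
open import Data.Vec using (Vec; []; _∷_; toList)
open import Data.List using (List; []; _∷_; map; allFin; concatMap; length; filter; head; last; [_])
open import Data.List.Relation.Unary.Unique.Propositional using (Unique)
open import Data.List.Relation.Unary.AllPairs using (allPairs?)
open import Data.Maybe using (Maybe; just; nothing)
import Data.Maybe.Properties as MaybeP
open import Data.Product using (_×_; _,_)
open import Data.Unit using (⊤; tt)
open import Relation.Nullary using (¬_; Dec; yes; no; ¬?)
open import Relation.Nullary.Decidable using (_×-dec_; _→-dec_)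
open import Relation.Binary.PropositionalEquality using (_≡_; _≢_)

-- Words of length m over the alphabet [m] = {1,…,m}.
-- An entry x : Fin m encodes the number  suc (toℕ x) ∈ {1,…,m}.

val : {m : ℕ} → Fin m → ℕ
val x = suc (toℕ x)

vals : {m : ℕ} → Vec (Fin m) m → List ℕ
vals π = map val (toList π)

Odd Even : ℕ → Set
Even a = 2 ∣ a
Odd a = ¬ (2 ∣ a)

AscentsOK : List ℕ → Set
AscentsOK []           = ⊤
AscentsOK (a ∷ [])     = ⊤
AscentsOK (a ∷ b ∷ xs) = (a < b → Odd a × Even b) × AscentsOK (b ∷ xs)

-- π ∈ 𝔊ᴵ_m : π is a permutation of [m] (m entries from [m], pairwise distinct)
-- and every ascent π_i < π_{i+1} has π_i odd and π_{i+1} even.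
InGI : (m : ℕ) → Vec (Fin m) m → Set
InGI m π = Unique (vals π) × AscentsOK (vals π)

FirstIs : {m : ℕ} → ℕ → Vec (Fin m) m → Set
FirstIs k π = head (vals π) ≡ just k

LastIs : {m : ℕ} → ℕ → Vec (Fin m) m → Set
LastIs k π = last (vals π) ≡ just k

-- Subtypes with an irrelevant membership proof (so that equality of
-- elements is equality of the underlying words).

record Sub {A : Set} (P : A → Set) : Set where
  constructor ⟨_,_⟩
  field
    elem  : A
    .prf  : P elem
open Sub public

GI-first-notLast2 : (n k : ℕ) → Set
GI-first-notLast2 n k =
  Sub (λ (π : Vec (Fin (2 * n)) (2 * n)) → InGI (2 * n) π × FirstIs k π × ¬ LastIs 2 π)

GI-first-last2 : (n k : ℕ) → Set
GI-first-last2 n k =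
  Sub (λ (π : Vec (Fin (2 * n)) (2 * n)) → InGI (2 * n) π × FirstIs k π × LastIs 2 π)

allFins : (m : ℕ) → List (Fin m)
allFins m = allFin m

allVecs : (m l : ℕ) → List (Vec (Fin m) l)
allVecs m zero    = [ [] ]
allVecs m (suc l) = concatMap (λ x → map (x ∷_) (allVecs m l)) (allFins m)

ascentsOK? : (xs : List ℕ) → Dec (AscentsOK xs)
ascentsOK? []           = yes tt
ascentsOK? (a ∷ [])     = yes tt
ascentsOK? (a ∷ b ∷ xs) =
  ((a <? b) →-dec (¬? (2 ∣? a) ×-dec (2 ∣? b))) ×-dec ascentsOK? (b ∷ xs)

inGIFirst? : (m k : ℕ) (π : Vec (Fin m) m) → Dec (InGI m π × FirstIs k π)
inGIFirst? m k π =
  (allPairs? (λ x y → ¬? (x ≟ y)) (vals π) ×-dec ascentsOK? (vals π))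
  ×-dec MaybeP.≡-dec _≟_ (head (vals π)) (just k)

G : (n k : ℕ) → ℕ
G n k = length (filter (inGIFirst? (2 * n) k) (allVecs (2 * n) (2 * n)))

{-# OPTIONS --safe #-}
module Submission where

-- In a permutation of 𝔊ᴵ the entry 2 cannot start an ascent, so it is either the last
-- entry or immediately followed by 1.  Moving it between these two places,
-- α 2 1 β ↔ α 1 β 2, preserves the ascent condition (the only ascent that can appear or
-- disappear is 1 2) and changes the first entry only when α is empty, where it exchanges
-- 1 and 2.  For k ≥ 3 this pairs the permutations starting with k that end in 2 with those
-- that do not.  A permutation starting with 1 must end in 2 and one starting with 2
-- cannot, so the same move also pairs the permutations starting with 1 and with 2.

open import Defs
open import Data.Bool using (true; false; if_then_else_)
open import Data.Empty using (⊥-elim)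
open import Data.Fin using (Fin; fromℕ<)
open import Data.Fin.Properties using (toℕ-injective; toℕ-fromℕ<) renaming (_≟_ to _≟ᶠ_)
open import Data.List using (List; []; _∷_; _++_; [_]; map; length; filter; head; last; allFin)
open import Data.List.Properties
  using (length-++; ++-assoc; map-++; length-map; map-∘; map-id-local; map-injective;
         length-filter; length-tabulate)
open import Data.List.Membership.Propositional using (_∈_; _∉_)
open import Data.List.Membership.Propositional.Properties
  using (∈-map⁺; ∈-map⁻; ∈-filter⁺; ∈-filter⁻; ∈-++⁺ʳ; ∈-++⁻; ∈-∃++; ∈-allFin; ∈-concatMap⁺)
open import Data.List.Membership.Propositional.Properties.WithK using (unique∧set⇒bag)
open import Data.List.Relation.Binary.BagAndSetEquality using (∼bag⇒↭)
open import Data.List.Relation.Binary.Disjoint.Propositional using (Disjoint)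
open import Data.List.Relation.Binary.Permutation.Propositional using (_↭_; ↭-sym; ↭⇒↭ₛ)
open import Data.List.Relation.Binary.Permutation.Propositional.Properties
  using (↭-length; ++⁺ˡ; ∷↭∷ʳ; All-resp-↭; Any-resp-↭)
open import Data.List.Relation.Binary.Permutation.Setoid.Properties using (Unique-resp-↭)
open import Data.List.Relation.Unary.All using (All; []; _∷_)
import Data.List.Relation.Unary.All as All
open import Data.List.Relation.Unary.All.Properties using (all-filter; ++⁻; ¬Any⇒All¬; map⁺)
import Data.List.Relation.Unary.AllPairs as AllPairs
open import Data.List.Relation.Unary.AllPairs using ([]; _∷_)
import Data.List.Relation.Unary.AllPairs.Properties as AllPairs
open import Data.List.Relation.Unary.Any using (here; there; any?)
import Data.List.Relation.Unary.Any as Any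
open import Data.List.Relation.Unary.Unique.Propositional using (Unique)
import Data.List.Relation.Unary.Unique.Propositional.Properties as Unique
open import Data.List.Relation.Unary.Unique.Propositional.Properties using (Unique[x∷xs]⇒x∉xs)
open import Data.Maybe using (just)
import Data.Maybe as Maybe
import Data.Maybe.Properties as Maybe
open import Data.Nat using (ℕ; zero; suc; _+_; _*_; _≤_; _<_; z≤n; s≤s)
open import Data.Nat.Divisibility using (_∣_; divides; ∣-refl; ∣1⇒≡1)
open import Data.Nat.Properties
  using (_≟_; +-comm; +-suc; +-identityʳ; *-comm; *-monoʳ-≤; ≤-refl; ≤-trans; suc-injective;
         1+n≰n; module ≤-Reasoning)
open import Data.Product using (_×_; _,_; proj₁; proj₂; ∃; ∃₂; assocʳ′; assocˡ′)
open import Data.Product.Function.NonDependent.Propositional using (_×-⇔_)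
open import Data.Sum using (inj₁; inj₂)
open import Data.Unit using (tt)
open import Data.Vec using (Vec; []; _∷_; toList; fromList; cast)
open import Data.Vec.Properties
  using (∷-injectiveˡ; ∷-injectiveʳ; toList-cast; toList∘fromList; length-toList;
         toList-injective; cast-is-id)
open import Function.Base using (_∘_)
open import Function.Bundles using (_⤖_; _⇔_; mk⇔; mk↔ₛ′; Equivalence)
open import Function.Definitions using (Injective)
open import Function.Properties.Equivalence using () renaming (sym to ⇔-sym)
open import Function.Properties.Inverse using (↔⇒⤖)
open import Function.Related.Propositional using (module EquationalReasoning)
open import Level using (0ℓ)
open import Relation.Binary.Definitions using (DecidableEquality)
open import Relation.Binary.PropositionalEquality
  using (_≡_; _≢_; refl; sym; trans; cong; cong₂; subst; setoid; module ≡-Reasoning)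
open import Relation.Nullary using (¬_; Dec; yes; no; ¬?; does)
open import Relation.Nullary.Decidable using (_×-dec_; dec-true; dec-false; recompute; map′)
open import Relation.Unary using (Pred; Decidable; _∩_; _≐_; ∁)

Sub-≡ : {A : Set} {P : Pred A 0ℓ} {s t : Sub P} → elem s ≡ elem t → s ≡ t
Sub-≡ {s = ⟨ x , _ ⟩} {⟨ .x , _ ⟩} refl = refl

record InverseOn {X : Set} (to from : X → X) (P Q : Pred X 0ℓ) : Set where
  field
    to-maps   : ∀ {x} → P x → Q (to x)
    from-maps : ∀ {y} → Q y → P (from y)
    from-to   : ∀ {x} → P x → from (to x) ≡ x
    to-from   : ∀ {y} → Q y → to (from y) ≡ y

module _ {X : Set} {to from : X → X} {P Q : Pred X 0ℓ} (inv : InverseOn to from P Q) where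
  open InverseOn inv

  InverseOn-restrict : {R S : Pred X 0ℓ} →
    (∀ {x} → P x → R x → S (to x)) → (∀ {y} → Q y → S y → R (from y)) →
    InverseOn to from (P ∩ R) (Q ∩ S)
  InverseOn-restrict R⇒S S⇒R = record
    { to-maps   = λ (p , r) → to-maps p , R⇒S p r
    ; from-maps = λ (q , s) → from-maps q , S⇒R q s
    ; from-to   = λ (p , _) → from-to p
    ; to-from   = λ (q , _) → to-from q
    }

  InverseOn-resp-≐ : {P′ Q′ : Pred X 0ℓ} → P′ ≐ P → Q′ ≐ Q → InverseOn to from P′ Q′
  InverseOn-resp-≐ (P′⊆P , P⊆P′) (Q′⊆Q , Q⊆Q′) = record
    { to-maps   = λ p → Q⊆Q′ (to-maps (P′⊆P p))
    ; from-maps = λ q → P⊆P′ (from-maps (Q′⊆Q q))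
    ; from-to   = λ p → from-to (P′⊆P p)
    ; to-from   = λ q → to-from (Q′⊆Q q)
    }

  InverseOn-pullback : {Y : Set} {h : Y → X} {to′ from′ : Y → Y} → Injective _≡_ _≡_ h →
    (∀ y → h (to′ y) ≡ to (h y)) → (∀ y → h (from′ y) ≡ from (h y)) →
    InverseOn to′ from′ (P ∘ h) (Q ∘ h)
  InverseOn-pullback {h = h} {to′} {from′} h-inj h∘to′ h∘from′ = record
    { to-maps   = λ {y} p → subst Q (sym (h∘to′ y)) (to-maps p)
    ; from-maps = λ {y} q → subst P (sym (h∘from′ y)) (from-maps q)
    ; from-to   = λ {y} p → h-inj (begin
        h (from′ (to′ y)) ≡⟨ h∘from′ (to′ y) ⟩
        from (h (to′ y))  ≡⟨ cong from (h∘to′ y) ⟩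
        from (to (h y))   ≡⟨ from-to p ⟩
        h y               ∎)
    ; to-from   = λ {y} q → h-inj (begin
        h (to′ (from′ y)) ≡⟨ h∘to′ (from′ y) ⟩
        to (h (from′ y))  ≡⟨ cong to (h∘from′ y) ⟩
        to (from (h y))   ≡⟨ to-from q ⟩
        h y               ∎)
    }
    where open ≡-Reasoning

  module _ (P? : Decidable P) (Q? : Decidable Q) where

    InverseOn⇒Sub⤖ : Sub P ⤖ Sub Q
    InverseOn⇒Sub⤖ = ↔⇒⤖ (mk↔ₛ′ f g f∘g g∘f)
      where
      f : Sub P → Sub Q
      f ⟨ x , p ⟩ = ⟨ to x , to-maps p ⟩
      g : Sub Q → Sub P
      g ⟨ y , q ⟩ = ⟨ from y , from-maps q ⟩
      f∘g : ∀ s → f (g s) ≡ s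
      f∘g ⟨ y , q ⟩ = Sub-≡ (to-from (recompute (Q? y) q))
      g∘f : ∀ s → g (f s) ≡ s
      g∘f ⟨ x , p ⟩ = Sub-≡ (from-to (recompute (P? x) p))

    InverseOn⇒length-filter-≡ : (L : List X) → Unique L → (∀ x → x ∈ L) →
      length (filter P? L) ≡ length (filter Q? L)
    InverseOn⇒length-filter-≡ L L-unique L-complete = begin
      length (filter P? L)          ≡⟨ sym (length-map to (filter P? L)) ⟩
      length (map to (filter P? L)) ≡⟨ ↭-length (∼bag⇒↭ (unique∧set⇒bag image-unique
                                          (Unique.filter⁺ Q? L-unique) same-members)) ⟩
      length (filter Q? L)          ∎
      where
      open ≡-Reasoning
      image-unique : Unique (map to (filter P? L))
      image-unique = Unique.map⁻ (subst Unique (sym from∘to≡id) (Unique.filter⁺ P? L-unique))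
        where
        from∘to≡id : map from (map to (filter P? L)) ≡ filter P? L
        from∘to≡id = trans (sym (map-∘ (filter P? L)))
                           (map-id-local (All.map from-to (all-filter P? L)))
      same-members : ∀ {y} → y ∈ map to (filter P? L) ⇔ y ∈ filter Q? L
      same-members {y} = mk⇔ image⊆ ⊆image
        where
        image⊆ : y ∈ map to (filter P? L) → y ∈ filter Q? L
        image⊆ y∈ with x , x∈ , refl ← ∈-map⁻ to y∈ =
          ∈-filter⁺ Q? (L-complete (to x)) (to-maps (proj₂ (∈-filter⁻ P? {xs = L} x∈)))
        ⊆image : y ∈ filter Q? L → y ∈ map to (filter P? L)
        ⊆image y∈ = subst (_∈ map to (filter P? L)) (to-from q)
                      (∈-map⁺ to (∈-filter⁺ P? (L-complete (from y)) (from-maps q)))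
          where q = proj₂ (∈-filter⁻ Q? {xs = L} y∈)

Unique-++⁻ʳ : ∀ {A : Set} (xs : List A) {ys} → Unique (xs ++ ys) → Unique ys
Unique-++⁻ʳ []       u       = u
Unique-++⁻ʳ (x ∷ xs) (_ ∷ u) = Unique-++⁻ʳ xs u

Unique-++⇒∉ : ∀ {A : Set} (xs : List A) {ys x} → Unique (xs ++ ys) → x ∈ ys → x ∉ xs
Unique-++⇒∉ (a ∷ xs) (a∉ ∷ _) x∈ys (here refl)  = All.lookup a∉ (∈-++⁺ʳ xs x∈ys) refl
Unique-++⇒∉ (a ∷ xs) (_ ∷ u)  x∈ys (there x∈xs) = Unique-++⇒∉ xs u x∈ys x∈xs

Unique-⊆⇒length≤ : ∀ {A : Set} → DecidableEquality A → ∀ {xs ys : List A} →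
  Unique xs → Unique ys → (∀ {x} → x ∈ xs → x ∈ ys) → length xs ≤ length ys
Unique-⊆⇒length≤ _≟ᴬ_ {xs} {ys} xs-unique ys-unique xs⊆ys = begin
  length xs                   ≡⟨ ↭-length (∼bag⇒↭ (unique∧set⇒bag xs-unique
                                   (Unique.filter⁺ (_∈? xs) ys-unique) same-members)) ⟩
  length (filter (_∈? xs) ys) ≤⟨ length-filter (_∈? xs) ys ⟩
  length ys                   ∎
  where
  open ≤-Reasoning
  _∈?_ : ∀ x xs → Dec (x ∈ xs)
  x ∈? xs = any? (x ≟ᴬ_) xs
  same-members : ∀ {x} → x ∈ xs ⇔ x ∈ filter (_∈? xs) ys
  same-members = mk⇔ (λ x∈ → ∈-filter⁺ (_∈? xs) (xs⊆ys x∈) x∈)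
                     (λ x∈ → proj₂ (∈-filter⁻ (_∈? xs) {xs = ys} x∈))

length-filter-split : ∀ {X : Set} {A B : Pred X 0ℓ} (A? : Decidable A) (B? : Decidable B) L →
  length (filter A? L) ≡
    length (filter (λ x → A? x ×-dec B? x) L) + length (filter (λ x → A? x ×-dec ¬? (B? x)) L)
length-filter-split A? B? []      = refl
length-filter-split A? B? (x ∷ L) with A? x | B? x
... | yes _ | yes _ = cong suc (length-filter-split A? B? L)
... | yes _ | no  _ = trans (cong suc (length-filter-split A? B? L)) (sym (+-suc _ _))
... | no  _ | _     = length-filter-split A? B? L

last-++ : ∀ {A : Set} (xs : List A) {y} ys → last (xs ++ y ∷ ys) ≡ last (y ∷ ys)
last-++ []            ys = refl
last-++ (x ∷ [])      ys = refl
last-++ (x ∷ x′ ∷ xs) ys = last-++ (x′ ∷ xs) ys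

last-∈ : ∀ {A : Set} (xs : List A) {z} → last xs ≡ just z → z ∈ xs
last-∈ (x ∷ [])      refl = here refl
last-∈ (x ∷ x′ ∷ xs) eq   = there (last-∈ (x′ ∷ xs) eq)

last≡just⇒∷ʳ : ∀ {A : Set} (xs : List A) {z} → last xs ≡ just z → ∃ λ ys → xs ≡ ys ++ [ z ]
last≡just⇒∷ʳ (x ∷ [])      refl = [] , refl
last≡just⇒∷ʳ (x ∷ x′ ∷ xs) eq with ys , xs≡ ← last≡just⇒∷ʳ (x′ ∷ xs) eq = x ∷ ys , cong (x ∷_) xs≡

-- rotateʳ moves the last entry in front of the first marked entry; rotateˡ moves the entry
-- just before the first marked entry to the end (the head itself is never tested).
module Rotation {A : Set} {M : Pred A 0ℓ} (M? : Decidable M) where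

  last⁺ : A → List A → A
  last⁺ x []       = x
  last⁺ _ (y ∷ ys) = last⁺ y ys

  init⁺ : A → List A → List A
  init⁺ x []       = []
  init⁺ x (y ∷ ys) = x ∷ init⁺ y ys

  rotateʳ : List A → List A
  rotateʳ []       = []
  rotateʳ (x ∷ xs) = if does (M? x) then last⁺ x xs ∷ init⁺ x xs else x ∷ rotateʳ xs

  rotateˡ⁺ : A → List A → List A
  rotateˡ⁺ x []       = x ∷ []
  rotateˡ⁺ x (y ∷ ys) = if does (M? y) then y ∷ ys ++ [ x ] else x ∷ rotateˡ⁺ y ys

  rotateˡ : List A → List A
  rotateˡ []       = []
  rotateˡ (x ∷ xs) = rotateˡ⁺ x xs

  length-init⁺ : ∀ x xs → length (init⁺ x xs) ≡ length xs
  length-init⁺ x []       = refl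
  length-init⁺ x (y ∷ ys) = cong suc (length-init⁺ y ys)

  length-rotateʳ : ∀ xs → length (rotateʳ xs) ≡ length xs
  length-rotateʳ []       = refl
  length-rotateʳ (x ∷ xs) with does (M? x)
  ... | true  = cong suc (length-init⁺ x xs)
  ... | false = cong suc (length-rotateʳ xs)

  length-rotateˡ⁺ : ∀ x xs → length (rotateˡ⁺ x xs) ≡ suc (length xs)
  length-rotateˡ⁺ x []       = refl
  length-rotateˡ⁺ x (y ∷ ys) with does (M? y)
  ... | true  = cong suc (trans (length-++ ys) (+-comm (length ys) 1))
  ... | false = cong suc (length-rotateˡ⁺ y ys)

  length-rotateˡ : ∀ xs → length (rotateˡ xs) ≡ length xs
  length-rotateˡ []       = refl
  length-rotateˡ (x ∷ xs) = length-rotateˡ⁺ x xs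

  rotateʳ-++ : ∀ α {o} β t → All (∁ M) α → M o → rotateʳ (α ++ o ∷ β ++ [ t ]) ≡ α ++ t ∷ o ∷ β
  rotateʳ-++ []      {o} β t []          o∈M rewrite dec-true (M? o) o∈M =
    cong₂ _∷_ (last⁺-++ o β) (init⁺-++ o β)
    where
    last⁺-++ : ∀ x ys → last⁺ x (ys ++ [ t ]) ≡ t
    last⁺-++ x []       = refl
    last⁺-++ x (y ∷ ys) = last⁺-++ y ys
    init⁺-++ : ∀ x ys → init⁺ x (ys ++ [ t ]) ≡ x ∷ ys
    init⁺-++ x []       = refl
    init⁺-++ x (y ∷ ys) = cong (x ∷_) (init⁺-++ y ys)
  rotateʳ-++ (a ∷ α)     β t (a∉M ∷ α∉M) o∈M rewrite dec-false (M? a) a∉M =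
    cong (a ∷_) (rotateʳ-++ α β t α∉M o∈M)

  rotateˡ-++ : ∀ α t {o} β → All (∁ M) α → ¬ M t → M o →
    rotateˡ (α ++ t ∷ o ∷ β) ≡ α ++ o ∷ β ++ [ t ]
  rotateˡ-++ []      t {o} β []        _   o∈M rewrite dec-true (M? o) o∈M = refl
  rotateˡ-++ (a ∷ α) t {o} β (_ ∷ α∉M) t∉M o∈M = rotateˡ⁺-++ a α α∉M
    where
    rotateˡ⁺-++ : ∀ a α → All (∁ M) α → rotateˡ⁺ a (α ++ t ∷ o ∷ β) ≡ a ∷ α ++ o ∷ β ++ [ t ]
    rotateˡ⁺-++ a []      []          rewrite dec-false (M? t) t∉M | dec-true (M? o) o∈M = refl
    rotateˡ⁺-++ a (b ∷ α) (b∉M ∷ α∉M) rewrite dec-false (M? b) b∉M =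
      cong (a ∷_) (rotateˡ⁺-++ b α α∉M)

module _ {A B : Set} {M : Pred A 0ℓ} {N : Pred B 0ℓ} (M? : Decidable M) (N? : Decidable N)
         (h : A → B) (h-marks : ∀ a → does (N? (h a)) ≡ does (M? a)) where
  private
    module RA = Rotation M?
    module RB = Rotation N?

  map-rotateʳ : ∀ xs → map h (RA.rotateʳ xs) ≡ RB.rotateʳ (map h xs)
  map-rotateʳ []       = refl
  map-rotateʳ (x ∷ xs) rewrite h-marks x with does (M? x)
  ... | true  = cong₂ _∷_ (map-last⁺ x xs) (map-init⁺ x xs)
    where
    map-last⁺ : ∀ x xs → h (RA.last⁺ x xs) ≡ RB.last⁺ (h x) (map h xs)
    map-last⁺ x []       = refl
    map-last⁺ x (y ∷ ys) = map-last⁺ y ys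
    map-init⁺ : ∀ x xs → map h (RA.init⁺ x xs) ≡ RB.init⁺ (h x) (map h xs)
    map-init⁺ x []       = refl
    map-init⁺ x (y ∷ ys) = cong (h x ∷_) (map-init⁺ y ys)
  ... | false = cong (h x ∷_) (map-rotateʳ xs)

  map-rotateˡ : ∀ xs → map h (RA.rotateˡ xs) ≡ RB.rotateˡ (map h xs)
  map-rotateˡ []       = refl
  map-rotateˡ (x ∷ xs) = map-rotateˡ⁺ x xs
    where
    map-rotateˡ⁺ : ∀ x xs → map h (RA.rotateˡ⁺ x xs) ≡ RB.rotateˡ⁺ (h x) (map h xs)
    map-rotateˡ⁺ x []       = refl
    map-rotateˡ⁺ x (y ∷ ys) rewrite h-marks y with does (M? y)
    ... | true  = cong (h y ∷_) (map-++ h ys [ x ])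
    ... | false = cong (h x ∷_) (map-rotateˡ⁺ y ys)

odd-1 : Odd 1
odd-1 2∣1 with () ← ∣1⇒≡1 2∣1

ascentsOK-++ : ∀ xs {y} ys →
  AscentsOK (xs ++ y ∷ ys) ⇔ (AscentsOK (xs ++ [ y ]) × AscentsOK (y ∷ ys))
ascentsOK-++ xs {y} ys = mk⇔ (λ ok → prefix xs ok , suffix xs ok) (λ (ok₁ , ok₂) → join xs ok₁ ok₂)
  where
  prefix : ∀ xs → AscentsOK (xs ++ y ∷ ys) → AscentsOK (xs ++ [ y ])
  prefix []            _        = tt
  prefix (x ∷ [])      (c , _)  = c , tt
  prefix (x ∷ x′ ∷ xs) (c , ok) = c , prefix (x′ ∷ xs) ok
  suffix : ∀ xs → AscentsOK (xs ++ y ∷ ys) → AscentsOK (y ∷ ys)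
  suffix []            ok       = ok
  suffix (x ∷ [])      (_ , ok) = ok
  suffix (x ∷ x′ ∷ xs) (_ , ok) = suffix (x′ ∷ xs) ok
  join : ∀ xs → AscentsOK (xs ++ [ y ]) → AscentsOK (y ∷ ys) → AscentsOK (xs ++ y ∷ ys)
  join []            _         ok  = ok
  join (x ∷ [])      (c , _)   ok  = c , ok
  join (x ∷ x′ ∷ xs) (c , ok₁) ok₂ = c , join (x′ ∷ xs) ok₁ ok₂

ascentsOK-∷ʳ : ∀ {xs y} → All (1 ≤_) xs → y ≤ 2 → AscentsOK (xs ++ [ y ]) ⇔ AscentsOK xs
ascentsOK-∷ʳ {xs} {y} xs≥1 y≤2 = mk⇔ (drop xs) (add xs xs≥1)
  where
  ascent-1-2 : ∀ {x y} → 1 ≤ x → y ≤ 2 → x < y → Odd x × Even y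
  ascent-1-2 (s≤s z≤n) (s≤s (s≤s z≤n)) (s≤s (s≤s z≤n)) = odd-1 , ∣-refl
  drop : ∀ xs → AscentsOK (xs ++ [ y ]) → AscentsOK xs
  drop []            _        = tt
  drop (x ∷ [])      _        = tt
  drop (x ∷ x′ ∷ xs) (c , ok) = c , drop (x′ ∷ xs) ok
  add : ∀ xs → All (1 ≤_) xs → AscentsOK xs → AscentsOK (xs ++ [ y ])
  add []            _            _        = tt
  add (x ∷ [])      (x≥1 ∷ [])   _        = ascent-1-2 x≥1 y≤2 , tt
  add (x ∷ x′ ∷ xs) (_ ∷ x′xs≥1) (c , ok) = c , add (x′ ∷ xs) x′xs≥1 ok

ascentsOK-moveTwoToEnd : ∀ {α β} → All (1 ≤_) α → All (1 ≤_) β →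
  AscentsOK (α ++ 2 ∷ 1 ∷ β) ⇔ AscentsOK (α ++ 1 ∷ β ++ [ 2 ])
ascentsOK-moveTwoToEnd {α} {β} α≥1 β≥1 = begin
  AscentsOK (α ++ 2 ∷ 1 ∷ β)
    ∼⟨ ascentsOK-++ α (1 ∷ β) ⟩
  (AscentsOK (α ++ [ 2 ]) × AscentsOK (2 ∷ 1 ∷ β))
    ∼⟨ ascentsOK-∷ʳ α≥1 ≤-refl ×-⇔ descent-2-1 ⟩
  (AscentsOK α × AscentsOK (1 ∷ β))
    ∼⟨ ⇔-sym (ascentsOK-∷ʳ α≥1 (s≤s z≤n) ×-⇔ ascentsOK-∷ʳ (s≤s z≤n ∷ β≥1) ≤-refl) ⟩
  (AscentsOK (α ++ [ 1 ]) × AscentsOK (1 ∷ β ++ [ 2 ]))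
    ∼⟨ ⇔-sym (ascentsOK-++ α (β ++ [ 2 ])) ⟩
  AscentsOK (α ++ 1 ∷ β ++ [ 2 ])
    ∎
  where
  open EquationalReasoning
  descent-2-1 : AscentsOK (2 ∷ 1 ∷ β) ⇔ AscentsOK (1 ∷ β)
  descent-2-1 = mk⇔ proj₂ (λ ok → (λ { (s≤s ()) }) , ok)

successor-of-2 : ∀ {y β} → 1 ≤ y → 2 ∉ y ∷ β → AscentsOK (2 ∷ y ∷ β) → y ≡ 1
successor-of-2 {suc zero}          _ _  _         = refl
successor-of-2 {suc (suc zero)}    _ 2∉ _         = ⊥-elim (2∉ (here refl))
successor-of-2 {suc (suc (suc y))} _ _  (2<y , _) = ⊥-elim (proj₁ (2<y (s≤s (s≤s (s≤s z≤n)))) ∣-refl)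

-- What the argument uses of a permutation in 𝔊ᴵ_m with m ≥ 2.
record GIWord (xs : List ℕ) : Set where
  field
    unique    : Unique xs
    ascentsOK : AscentsOK xs
    positive  : All (1 ≤_) xs
    has-1     : 1 ∈ xs
    has-2     : 2 ∈ xs
open GIWord

GIWord-resp-↭ : ∀ {xs ys} → xs ↭ ys → (AscentsOK xs → AscentsOK ys) → GIWord xs → GIWord ys
GIWord-resp-↭ xs↭ys ascents w = record
  { unique    = Unique-resp-↭ (setoid ℕ) (↭⇒↭ₛ xs↭ys) (unique w)
  ; ascentsOK = ascents (ascentsOK w)
  ; positive  = All-resp-↭ xs↭ys (positive w)
  ; has-1     = Any-resp-↭ xs↭ys (has-1 w)
  ; has-2     = Any-resp-↭ xs↭ys (has-2 w)
  }

GIWord-moveTwoToEnd : ∀ {α β} → GIWord (α ++ 2 ∷ 1 ∷ β) ⇔ GIWord (α ++ 1 ∷ β ++ [ 2 ])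
GIWord-moveTwoToEnd {α} {β} = mk⇔
  (λ w → GIWord-resp-↭ moved (Equivalence.to (ascents (positive w))) w)
  (λ w → GIWord-resp-↭ (↭-sym moved)
           (Equivalence.from (ascents (All-resp-↭ (↭-sym moved) (positive w)))) w)
  where
  moved : α ++ 2 ∷ 1 ∷ β ↭ α ++ 1 ∷ β ++ [ 2 ]
  moved = ++⁺ˡ α (∷↭∷ʳ 2 (1 ∷ β))
  ascents : All (1 ≤_) (α ++ 2 ∷ 1 ∷ β) →
    AscentsOK (α ++ 2 ∷ 1 ∷ β) ⇔ AscentsOK (α ++ 1 ∷ β ++ [ 2 ])
  ascents positive with α≥1 , _ ∷ _ ∷ β≥1 ← ++⁻ α positive = ascentsOK-moveTwoToEnd α≥1 β≥1

StartsWith EndsWith : ℕ → Pred (List ℕ) 0ℓ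
StartsWith k xs = head xs ≡ just k
EndsWith   k xs = last xs ≡ just k

endsWith? : ∀ k → Decidable (EndsWith k)
endsWith? k xs = Maybe.≡-dec _≟_ (last xs) (just k)

TwoOne OneTwo : Pred (List ℕ) 0ℓ
TwoOne xs = ∃₂ λ α β → xs ≡ α ++ 2 ∷ 1 ∷ β
OneTwo xs = ∃₂ λ α β → xs ≡ α ++ 1 ∷ β ++ [ 2 ]

TwoOne⇒¬EndsWith2 : ∀ {xs} → Unique xs → TwoOne xs → ¬ EndsWith 2 xs
TwoOne⇒¬EndsWith2 u (α , β , refl) ends2 =
  Unique[x∷xs]⇒x∉xs (Unique-++⁻ʳ α u) (last-∈ (1 ∷ β) (trans (sym (last-++ α (1 ∷ β))) ends2))

OneTwo⇒EndsWith2 : ∀ {xs} → OneTwo xs → EndsWith 2 xs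
OneTwo⇒EndsWith2 (α , β , refl) =
  trans (cong last (sym (++-assoc α (1 ∷ β) [ 2 ]))) (last-++ (α ++ 1 ∷ β) [])

¬EndsWith2⇒TwoOne : ∀ {xs} → GIWord xs → ¬ EndsWith 2 xs → TwoOne xs
¬EndsWith2⇒TwoOne w ¬ends2 with ∈-∃++ (has-2 w)
... | α , []    , refl = ⊥-elim (¬ends2 (last-++ α []))
... | α , y ∷ β , refl
  with refl ← successor-of-2 (All.lookup (positive w) (∈-++⁺ʳ α (there (here refl))))
                             (Unique[x∷xs]⇒x∉xs (Unique-++⁻ʳ α (unique w)))
                             (proj₂ (Equivalence.to (ascentsOK-++ α (y ∷ β)) (ascentsOK w)))
  = α , β , refl

EndsWith2⇒OneTwo : ∀ {xs} → 1 ∈ xs → EndsWith 2 xs → OneTwo xs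
EndsWith2⇒OneTwo {xs} 1∈xs ends2 with ys , refl ← last≡just⇒∷ʳ xs ends2 with ∈-++⁻ ys 1∈xs
... | inj₁ 1∈ys with α , β , refl ← ∈-∃++ 1∈ys = α , β , ++-assoc α (1 ∷ β) [ 2 ]
... | inj₂ (here ())

moveTwoToEnd moveLastBeforeOne : List ℕ → List ℕ
moveTwoToEnd      = Rotation.rotateˡ (1 ≟_)
moveLastBeforeOne = Rotation.rotateʳ (1 ≟_)

moveTwoToEnd-++ : ∀ α β → 1 ∉ α → moveTwoToEnd (α ++ 2 ∷ 1 ∷ β) ≡ α ++ 1 ∷ β ++ [ 2 ]
moveTwoToEnd-++ α β 1∉α = Rotation.rotateˡ-++ (1 ≟_) α 2 β (¬Any⇒All¬ α 1∉α) (λ ()) refl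

moveLastBeforeOne-++ : ∀ α β → 1 ∉ α → moveLastBeforeOne (α ++ 1 ∷ β ++ [ 2 ]) ≡ α ++ 2 ∷ 1 ∷ β
moveLastBeforeOne-++ α β 1∉α = Rotation.rotateʳ-++ (1 ≟_) α β 2 (¬Any⇒All¬ α 1∉α) refl

moveTwoToEnd-inverseOn :
  InverseOn moveTwoToEnd moveLastBeforeOne (GIWord ∩ TwoOne) (GIWord ∩ OneTwo)
moveTwoToEnd-inverseOn = record
  { to-maps   = λ { (w , α , β , refl) →
      subst (GIWord ∩ OneTwo) (sym (moveTwoToEnd-++ α β (1∉ˡ w)))
        (Equivalence.to GIWord-moveTwoToEnd w , α , β , refl) }
  ; from-maps = λ { (w , α , β , refl) →
      subst (GIWord ∩ TwoOne) (sym (moveLastBeforeOne-++ α β (1∉ʳ w)))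
        (Equivalence.from GIWord-moveTwoToEnd w , α , β , refl) }
  ; from-to   = λ { (w , α , β , refl) →
      trans (cong moveLastBeforeOne (moveTwoToEnd-++ α β (1∉ˡ w))) (moveLastBeforeOne-++ α β (1∉ˡ w)) }
  ; to-from   = λ { (w , α , β , refl) →
      trans (cong moveTwoToEnd (moveLastBeforeOne-++ α β (1∉ʳ w))) (moveTwoToEnd-++ α β (1∉ʳ w)) }
  }
  where
  1∉ˡ : ∀ {α β} → GIWord (α ++ 2 ∷ 1 ∷ β) → 1 ∉ α
  1∉ˡ {α} w = Unique-++⇒∉ α (unique w) (there (here refl))
  1∉ʳ : ∀ {α β} → GIWord (α ++ 1 ∷ β ++ [ 2 ]) → 1 ∉ α
  1∉ʳ {α} w = Unique-++⇒∉ α (unique w) (here refl)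

swap₁₂ : ℕ → ℕ
swap₁₂ 1 = 2
swap₁₂ 2 = 1
swap₁₂ k = k

swap₁₂-involutive : ∀ k → swap₁₂ (swap₁₂ k) ≡ k
swap₁₂-involutive 0                   = refl
swap₁₂-involutive 1                   = refl
swap₁₂-involutive 2                   = refl
swap₁₂-involutive (suc (suc (suc k))) = refl

swap₁₂-fixes : ∀ {k} → k ≢ 1 → k ≢ 2 → swap₁₂ k ≡ k
swap₁₂-fixes {0}                 _   _   = refl
swap₁₂-fixes {1}                 k≢1 _   = ⊥-elim (k≢1 refl)
swap₁₂-fixes {2}                 _   k≢2 = ⊥-elim (k≢2 refl)
swap₁₂-fixes {suc (suc (suc k))} _   _   = refl

head-swap₁₂ : ∀ α {y} xs ys → 1 ∉ α → 2 ∉ α →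
  head (α ++ swap₁₂ y ∷ xs) ≡ Maybe.map swap₁₂ (head (α ++ y ∷ ys))
head-swap₁₂ []      xs ys _   _   = refl
head-swap₁₂ (a ∷ α) xs ys 1∉α 2∉α =
  cong just (sym (swap₁₂-fixes (λ a≡1 → 1∉α (here (sym a≡1))) (λ a≡2 → 2∉α (here (sym a≡2)))))

moveTwoToEnd-inverseOn-startsWith : ∀ k → InverseOn moveTwoToEnd moveLastBeforeOne
  ((GIWord ∩ StartsWith k) ∩ ∁ (EndsWith 2)) ((GIWord ∩ StartsWith (swap₁₂ k)) ∩ EndsWith 2)
moveTwoToEnd-inverseOn-startsWith k =
  InverseOn-resp-≐ (InverseOn-restrict moveTwoToEnd-inverseOn head-to head-from)
    ( (λ ((w , s) , ¬e) → (w , ¬EndsWith2⇒TwoOne w ¬e) , s)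
    , (λ ((w , t) , s) → (w , s) , TwoOne⇒¬EndsWith2 (unique w) t))
    ( (λ ((w , s) , e) → (w , EndsWith2⇒OneTwo (has-1 w) e) , s)
    , (λ ((w , t) , s) → (w , s) , OneTwo⇒EndsWith2 t))
  where
  open ≡-Reasoning
  head-to : ∀ {xs} → (GIWord ∩ TwoOne) xs → StartsWith k xs →
    StartsWith (swap₁₂ k) (moveTwoToEnd xs)
  head-to (w , α , β , refl) starts = begin
    head (moveTwoToEnd (α ++ 2 ∷ 1 ∷ β))     ≡⟨ cong head (moveTwoToEnd-++ α β 1∉α) ⟩
    head (α ++ 1 ∷ β ++ [ 2 ])               ≡⟨ head-swap₁₂ α (β ++ [ 2 ]) (1 ∷ β) 1∉α 2∉α ⟩
    Maybe.map swap₁₂ (head (α ++ 2 ∷ 1 ∷ β)) ≡⟨ cong (Maybe.map swap₁₂) starts ⟩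
    just (swap₁₂ k)                          ∎
    where
    1∉α = Unique-++⇒∉ α (unique w) (there (here refl))
    2∉α = Unique-++⇒∉ α (unique w) (here refl)
  head-from : ∀ {ys} → (GIWord ∩ OneTwo) ys → StartsWith (swap₁₂ k) ys →
    StartsWith k (moveLastBeforeOne ys)
  head-from (w , α , β , refl) starts = begin
    head (moveLastBeforeOne (α ++ 1 ∷ β ++ [ 2 ])) ≡⟨ cong head (moveLastBeforeOne-++ α β 1∉α) ⟩
    head (α ++ 2 ∷ 1 ∷ β)                          ≡⟨ head-swap₁₂ α (1 ∷ β) (β ++ [ 2 ]) 1∉α 2∉α ⟩
    Maybe.map swap₁₂ (head (α ++ 1 ∷ β ++ [ 2 ]))  ≡⟨ cong (Maybe.map swap₁₂) starts ⟩
    just (swap₁₂ (swap₁₂ k))                       ≡⟨ cong just (swap₁₂-involutive k) ⟩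
    just k                                         ∎
    where
    1∉α = Unique-++⇒∉ α (unique w) (here refl)
    2∉α = Unique-++⇒∉ α (unique w) (there (∈-++⁺ʳ β (here refl)))

StartsWith2⇒¬EndsWith2 : ∀ {xs} → GIWord xs → StartsWith 2 xs → ¬ EndsWith 2 xs
StartsWith2⇒¬EndsWith2 {_ ∷ []}     w refl _ with has-1 w
... | here ()
... | there ()
StartsWith2⇒¬EndsWith2 {_ ∷ y ∷ ys} w refl ends2 =
  Unique[x∷xs]⇒x∉xs (unique w) (last-∈ (y ∷ ys) ends2)

-- Otherwise 2 is followed by 1, so 1 is not the first entry.
StartsWith1⇒EndsWith2 : ∀ {xs} → GIWord xs → StartsWith 1 xs → EndsWith 2 xs
StartsWith1⇒EndsWith2 {xs} w starts with endsWith? 2 xs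
... | yes ends2 = ends2
... | no ¬ends2 with α , β , refl ← ¬EndsWith2⇒TwoOne w ¬ends2 with α | starts
...   | a ∷ α′ | refl = ⊥-elim (Unique-++⇒∉ (a ∷ α′) (unique w) (there (here refl)) (here refl))

module _ {A : Set} (f : List A → List A) (f-length : ∀ xs → length (f xs) ≡ length xs) where

  onVec : ∀ {n} → Vec A n → Vec A n
  onVec v = cast (trans (f-length (toList v)) (length-toList v)) (fromList (f (toList v)))

  toList-onVec : ∀ {n} (v : Vec A n) → toList (onVec v) ≡ f (toList v)
  toList-onVec v = trans (toList-cast _ (fromList (f (toList v)))) (toList∘fromList (f (toList v)))

module _ {m : ℕ} where

  private
    is1? : Decidable (λ (x : Fin m) → 1 ≡ val x)
    is1? x = 1 ≟ val x

  moveTwoToEndᵛ moveLastBeforeOneᵛ : Vec (Fin m) m → Vec (Fin m) m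
  moveTwoToEndᵛ      = onVec (Rotation.rotateˡ is1?) (Rotation.length-rotateˡ is1?)
  moveLastBeforeOneᵛ = onVec (Rotation.rotateʳ is1?) (Rotation.length-rotateʳ is1?)

  vals-moveTwoToEnd : ∀ π → vals (moveTwoToEndᵛ π) ≡ moveTwoToEnd (vals π)
  vals-moveTwoToEnd π =
    trans (cong (map val) (toList-onVec (Rotation.rotateˡ is1?) (Rotation.length-rotateˡ is1?) π))
          (map-rotateˡ is1? (1 ≟_) val (λ _ → refl) (toList π))

  vals-moveLastBeforeOne : ∀ π → vals (moveLastBeforeOneᵛ π) ≡ moveLastBeforeOne (vals π)
  vals-moveLastBeforeOne π =
    trans (cong (map val) (toList-onVec (Rotation.rotateʳ is1?) (Rotation.length-rotateʳ is1?) π))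
          (map-rotateʳ is1? (1 ≟_) val (λ _ → refl) (toList π))

  vals-injective : Injective _≡_ _≡_ (vals {m})
  vals-injective {π} {σ} eq = trans (sym (cast-is-id refl π))
    (toList-injective refl π σ (map-injective (toℕ-injective ∘ suc-injective) eq))

Unique⇒∈ : ∀ {m} (π : Vec (Fin m) m) → Unique (toList π) → ∀ i → i ∈ toList π
Unique⇒∈ {m} π π-unique i with any? (i ≟ᶠ_) (toList π)
... | yes i∈π = i∈π
... | no  i∉π = ⊥-elim (1+n≰n (begin
  suc m                 ≡⟨ cong suc (sym (length-toList π)) ⟩
  length (i ∷ toList π) ≤⟨ Unique-⊆⇒length≤ _≟ᶠ_ (¬Any⇒All¬ _ i∉π ∷ π-unique) (Unique.allFin⁺ m)
                             (λ {j} _ → ∈-allFin j) ⟩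
  length (allFin m)     ≡⟨ length-tabulate {n = m} (λ j → j) ⟩
  m                     ∎))
  where open ≤-Reasoning

module _ {m : ℕ} (2≤m : 2 ≤ m) where

  InGI≐GIWord : InGI m ≐ GIWord ∘ vals
  InGI≐GIWord = (λ {π} (π-unique , π-ascents) → record
    { unique    = π-unique
    ; ascentsOK = π-ascents
    ; positive  = map⁺ (All.universal (λ _ → s≤s z≤n) (toList π))
    ; has-1     = ∈-vals π π-unique (≤-trans (s≤s z≤n) 2≤m)
    ; has-2     = ∈-vals π π-unique 2≤m
    }) , (λ w → unique w , ascentsOK w)
    where
    ∈-vals : ∀ π → Unique (vals π) → ∀ {b} (b<m : b < m) → suc b ∈ vals π
    ∈-vals π π-unique b<m = subst (_∈ vals π) (cong suc (toℕ-fromℕ< b<m))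
      (∈-map⁺ val (Unique⇒∈ π (Unique.map⁻ π-unique) (fromℕ< b<m)))

  moveTwoToEndᵛ-inverseOn-firstIs : ∀ k → InverseOn moveTwoToEndᵛ moveLastBeforeOneᵛ
    ((InGI m ∩ FirstIs k) ∩ ∁ (LastIs 2)) ((InGI m ∩ FirstIs (swap₁₂ k)) ∩ LastIs 2)
  moveTwoToEndᵛ-inverseOn-firstIs k =
    InverseOn-resp-≐
      (InverseOn-pullback (moveTwoToEnd-inverseOn-startsWith k)
        vals-injective vals-moveTwoToEnd vals-moveLastBeforeOne)
      (first-component InGI≐GIWord) (first-component InGI≐GIWord)
    where
    first-component : ∀ {P Q R S : Pred (Vec (Fin m) m) 0ℓ} → P ≐ Q → ((P ∩ R) ∩ S) ≐ ((Q ∩ R) ∩ S)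
    first-component (P⊆Q , Q⊆P) =
      (λ ((p , r) , s) → (P⊆Q p , r) , s) , (λ ((q , r) , s) → (Q⊆P q , r) , s)

  -- Once k is seen to be at least 3, swap₁₂ k reduces to k.
  moveTwoToEndᵛ-inverseOn-first≥3 : ∀ {k} → 3 ≤ k → InverseOn moveTwoToEndᵛ moveLastBeforeOneᵛ
    ((InGI m ∩ FirstIs k) ∩ ∁ (LastIs 2)) ((InGI m ∩ FirstIs k) ∩ LastIs 2)
  moveTwoToEndᵛ-inverseOn-first≥3 (s≤s (s≤s (s≤s _))) = moveTwoToEndᵛ-inverseOn-firstIs _

  moveTwoToEndᵛ-inverseOn-first2 :
    InverseOn moveTwoToEndᵛ moveLastBeforeOneᵛ (InGI m ∩ FirstIs 2) (InGI m ∩ FirstIs 1)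
  moveTwoToEndᵛ-inverseOn-first2 = InverseOn-resp-≐ (moveTwoToEndᵛ-inverseOn-firstIs 2)
    ((λ (g , s) → (g , s) , StartsWith2⇒¬EndsWith2 (proj₁ InGI≐GIWord g) s) , proj₁)
    ((λ (g , s) → (g , s) , StartsWith1⇒EndsWith2 (proj₁ InGI≐GIWord g) s) , proj₁)

allVecs-complete : ∀ m l (v : Vec (Fin m) l) → v ∈ allVecs m l
allVecs-complete m zero    []      = here refl
allVecs-complete m (suc l) (x ∷ v) = ∈-concatMap⁺ (λ y → map (y ∷_) (allVecs m l))
  (Any.map (λ { refl → ∈-map⁺ (x ∷_) (allVecs-complete m l v) }) (∈-allFin x))

allVecs-unique : ∀ m l → Unique (allVecs m l)
allVecs-unique m zero    = [] ∷ []
allVecs-unique m (suc l) =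
  Unique.concat⁺
    (map⁺ (All.universal (λ _ → Unique.map⁺ ∷-injectiveʳ (allVecs-unique m l)) (allFin m)))
    (AllPairs.map⁺ (AllPairs.map disjoint (Unique.allFin⁺ m)))
  where
  disjoint : ∀ {x y : Fin m} → x ≢ y → Disjoint (map (x ∷_) (allVecs m l)) (map (y ∷_) (allVecs m l))
  disjoint x≢y (v∈ , v∈′) with _ , _ , refl ← ∈-map⁻ _ v∈ | _ , _ , eq ← ∈-map⁻ _ v∈′ =
    x≢y (∷-injectiveˡ eq)

module _ {m : ℕ} where

  count : {P : Pred (Vec (Fin m) m) 0ℓ} → Decidable P → ℕ
  count P? = length (filter P? (allVecs m m))

  count-≡ : ∀ {f g} {P Q : Pred (Vec (Fin m) m) 0ℓ} → InverseOn f g P Q →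
    (P? : Decidable P) (Q? : Decidable Q) → count P? ≡ count Q?
  count-≡ inv P? Q? =
    InverseOn⇒length-filter-≡ inv P? Q? (allVecs m m) (allVecs-unique m m) (allVecs-complete m m)

  lastIs2? : Decidable (LastIs {m} 2)
  lastIs2? π = endsWith? 2 (vals π)

module _ {m : ℕ} (2≤m : 2 ≤ m) where

  notLast2⤖last2 : ∀ {k} → 3 ≤ k →
    Sub (λ π → InGI m π × FirstIs k π × ¬ LastIs 2 π) ⤖ Sub (λ π → InGI m π × FirstIs k π × LastIs 2 π)
  notLast2⤖last2 {k} k≥3 =
    InverseOn⇒Sub⤖ (InverseOn-resp-≐ (moveTwoToEndᵛ-inverseOn-first≥3 2≤m k≥3) reassoc reassoc)
      (λ π → map′ assocʳ′ assocˡ′ (inGIFirst? m k π ×-dec ¬? (lastIs2? π)))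
      (λ π → map′ assocʳ′ assocˡ′ (inGIFirst? m k π ×-dec lastIs2? π))
    where
    reassoc : ∀ {P Q R : Pred (Vec (Fin m) m) 0ℓ} → (λ π → P π × Q π × R π) ≐ ((P ∩ Q) ∩ R)
    reassoc = assocˡ′ , assocʳ′

  count-first-even : ∀ {k} → 3 ≤ k → 2 ∣ count (inGIFirst? m k)
  count-first-even {k} k≥3 = divides (count last2?) (begin
    count (inGIFirst? m k)       ≡⟨ length-filter-split (inGIFirst? m k) lastIs2? (allVecs m m) ⟩
    count last2? + count ¬last2? ≡⟨ cong (count last2? +_)
                                      (count-≡ (moveTwoToEndᵛ-inverseOn-first≥3 2≤m k≥3) ¬last2? last2?) ⟩
    count last2? + count last2?  ≡⟨ cong (count last2? +_) (sym (+-identityʳ _)) ⟩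
    2 * count last2?             ≡⟨ *-comm 2 (count last2?) ⟩
    count last2? * 2             ∎)
    where
    open ≡-Reasoning
    last2? = λ π → inGIFirst? m k π ×-dec lastIs2? π
    ¬last2? = λ π → inGIFirst? m k π ×-dec ¬? (lastIs2? π)

  count-first1≡first2 : count (inGIFirst? m 1) ≡ count (inGIFirst? m 2)
  count-first1≡first2 =
    sym (count-≡ (moveTwoToEndᵛ-inverseOn-first2 2≤m) (inGIFirst? m 2) (inGIFirst? m 1))

proposition3p13 : (n : ℕ) → 1 ≤ n →
    ((k : ℕ) → 3 ≤ k → (GI-first-notLast2 n k ⤖ GI-first-last2 n k) × (2 ∣ G n k))
    × (G n 1 ≡ G n 2)
proposition3p13 n n≥1 =
  (λ k k≥3 → notLast2⤖last2 2≤2n k≥3 , count-first-even 2≤2n k≥3) , count-first1≡first2 2≤2n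
  where
  2≤2n : 2 ≤ 2 * n
  2≤2n = *-monoʳ-≤ 2 n≥1
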